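{- For every integer $m\ge 2$ there is a graph $G$ having at least $m!$ pairwise nonisomorphic exact-distance square roots which are trees, i.e. there are trees $T_1,\dots,T_{m!}$, pairwise nonisomorphic, each satisfying $T_i^{[\sharp 2]}\cong G$.
   Context: All graphs are finite and simple. For a graph $H=(V,E)$, its exact-distance square $H^{[\sharp 2]}$ is the graph with vertex set $V$ in which distinct vertices $x,y$ are adjacent if and only if their distance in $H$ is exactly $2$. A graph $H$ is an exact-distance square root of $G$ if $H^{[\sharp 2]}$ is (isomorphic to) $G$. -}

module Defs where

open import Data.Nat using (ℕ; zero; suc; _≤_)
open import Data.Fin using (Fin)
open import Data.List using (List; []; _∷_; length; head; last)
open import Data.List.Relation.Unary.Unique.Propositional using (Unique)
open import Data.Maybe using (Maybe; just; nothing)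
open import Data.Product using (Σ; ∃; ∃-syntax; _×_; _,_)
open import Data.Empty using (⊥)
open import Function.Bundles using (_↔_; _⇔_; Inverse)
open import Relation.Binary.PropositionalEquality using (_≡_; _≢_)
open import Relation.Nullary using (¬_)

record Graph (n : ℕ) : Set₁ where
  field
    Adj    : Fin n → Fin n → Set
    sym    : ∀ {x y} → Adj x y → Adj y x
    irrefl : ∀ {x} → ¬ Adj x x
open Graph public

data IsWalk {n : ℕ} (H : Graph n) : List (Fin n) → Set where
  walk-nil  : IsWalk H []
  walk-one  : ∀ x → IsWalk H (x ∷ [])
  walk-cons : ∀ {x y vs} → Adj H x y → IsWalk H (y ∷ vs) → IsWalk H (x ∷ y ∷ vs)

Connected : ∀ {n} → Graph n → Set
Connected {n} H = ∀ (x y : Fin n) → ∃[ vs ] (IsWalk H vs × head vs ≡ just x × last vs ≡ just y)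

IsCycle : ∀ {n} → Graph n → List (Fin n) → Set
IsCycle {n} H vs = 3 ≤ length vs × Unique vs × IsWalk H vs ×
  ∃[ a ] ∃[ b ] (head vs ≡ just a × last vs ≡ just b × Adj H b a)

Acyclic : ∀ {n} → Graph n → Set
Acyclic {n} H = ∀ (vs : List (Fin n)) → ¬ IsCycle H vs

IsTree : ∀ {n} → Graph n → Set
IsTree {n} H = 1 ≤ n × Connected H × Acyclic H

DistTwo : ∀ {n} → Graph n → Fin n → Fin n → Set
DistTwo {n} H x y = x ≢ y × ¬ Adj H x y × ∃[ z ] (Adj H x z × Adj H z y)

ExactSq : ∀ {n} → Graph n → Graph n
ExactSq {n} H = record { Adj = DistTwo H ; sym = s ; irrefl = i }
  where
  s : ∀ {x y} → DistTwo H x y → DistTwo H y x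
  s (x≢y , nxy , z , xz , zy) =
    (λ e → x≢y (Relation.Binary.PropositionalEquality.sym e)) ,
    (λ a → nxy (Graph.sym H a)) , z , Graph.sym H zy , Graph.sym H xz
  i : ∀ {x} → ¬ DistTwo H x x
  i (x≢x , _) = x≢x Relation.Binary.PropositionalEquality.refl

Iso : ∀ {n m} → Graph n → Graph m → Set
Iso {n} {m} G H = Σ (Fin n ↔ Fin m) λ f →
  ∀ x y → Adj G x y ⇔ Adj H (Inverse.to f x) (Inverse.to f y)

-- Take a root c with children x₀ … x_N, groups y_{j,0} … y_{j,j} (0 ≤ j ≤ N)
-- of pairwise different sizes, and A = N + 2 further vertices z_b.  The tree
-- T_s (0 ≤ s ≤ N) hangs group s below x₀, group 0 below x_s, every other group
-- j below x_j, and all z_b below the hub y_{s,0}.  In a tree, exact distance two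
-- means siblings or grandparent; in every T_s the sibling classes are the x's,
-- the groups and the z's, and the grandparent pairs are (y, c) and (z, x₀), so
-- all T_s have the same exact square.  They are pairwise non-isomorphic: the
-- hub is the only vertex of degree ≥ A + 1, and its only non-leaf neighbour x₀
-- has degree s + 2.  This gives any number of roots.
module Submission where

open import Defs hiding (sym; irrefl)
open import Data.Nat using (ℕ; zero; suc; _+_; _≤_; _<_; _!; z≤n; s≤s; s≤s⁻¹)
open import Data.Nat.Properties
  using (≤-reflexive; ≤-trans; <-trans; <-irrefl; <-asym; <⇒≱; 1+n≢n; suc-injective; n≤1+n; <-cmp)
open import Data.Fin using (Fin; zero; suc; toℕ; _≟_)
open import Data.Fin.Properties
  using (toℕ-injective; toℕ<n; toℕ≤pred[n]; +↔⊎; 1↔⊤; injective⇒≤)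
  renaming (suc-injective to Fin-suc-injective)
import Data.Fin.Permutation.Components as Perm
open import Data.Vec.Functional using (Vector; foldr)
open import Data.Product using (Σ; ∃-syntax; _×_; _,_; proj₁; proj₂)
open import Data.Sum using (_⊎_; inj₁; inj₂; swap)
open import Data.Sum.Function.Propositional using (_⊎-↔_)
open import Data.List using (List; []; _∷_; _∷ʳ_; head; last)
open import Data.List.Relation.Unary.All
  using (All; _∷_) renaming (map to All-map; lookup to All-lookup)
open import Data.List.Relation.Unary.AllPairs using (_∷_)
open import Data.List.Relation.Unary.Any using (here; there)
open import Data.List.Membership.Propositional using (_∈_)
open import Data.List.Relation.Unary.Unique.Propositional using (Unique)
open import Data.Maybe using (just)
open import Data.Empty using (⊥; ⊥-elim)
open import Data.Unit using (⊤; tt)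
open import Function using (_∘_)
open import Function.Bundles using (_↔_; Inverse; Equivalence; mk⇔; mk↔ₛ′)
open import Function.Definitions using (Injective)
open import Function.Properties.Inverse using (↔-refl; ↔-sym; ↔-trans)
open import Relation.Binary.Definitions using (tri<; tri≈; tri>)
open import Relation.Binary.PropositionalEquality
  using (_≡_; _≢_; refl; sym; trans; cong; subst; subst₂; ≢-sym; module ≡-Reasoning)
open import Relation.Nullary using (¬_; yes; no; Dec)
open import Relation.Nullary.Decidable using (map′)

<-of-≡suc : ∀ {m n} → m ≡ suc n → n < m
<-of-≡suc m≡1+n = ≤-reflexive (sym m≡1+n)

lastOf : ∀ {A : Set} → A → List A → A
lastOf x []       = x
lastOf _ (y ∷ ys) = lastOf y ys

last-∷ : ∀ {A : Set} (x : A) xs → last (x ∷ xs) ≡ just (lastOf x xs)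
last-∷ x []       = refl
last-∷ x (y ∷ ys) = last-∷ y ys

lastOf-∈ : ∀ {A : Set} (x : A) xs → lastOf x xs ∈ x ∷ xs
lastOf-∈ x []       = here refl
lastOf-∈ x (y ∷ ys) = there (lastOf-∈ y ys)

NonBacktracking : ∀ {A : Set} → List A → Set
NonBacktracking (x ∷ y ∷ z ∷ rest) = x ≢ z × NonBacktracking (y ∷ z ∷ rest)
NonBacktracking _                  = ⊤

nonBacktracking-tail : ∀ {A : Set} {x : A} xs → NonBacktracking (x ∷ xs) → NonBacktracking xs
nonBacktracking-tail []          _        = tt
nonBacktracking-tail (_ ∷ [])    _        = tt
nonBacktracking-tail (_ ∷ _ ∷ _) (_ , nb) = nb

unique⇒nonBacktracking : ∀ {A : Set} {xs : List A} → Unique xs → NonBacktracking xs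
unique⇒nonBacktracking {xs = []}            _                  = tt
unique⇒nonBacktracking {xs = _ ∷ []}        _                  = tt
unique⇒nonBacktracking {xs = _ ∷ _ ∷ []}    _                  = tt
unique⇒nonBacktracking {xs = _ ∷ _ ∷ _ ∷ _} ((_ ∷ x≢z ∷ _) ∷ u) =
  x≢z , unique⇒nonBacktracking u

nonBacktracking-∷ʳ : ∀ {A : Set} (x y z : A) rest {c} →
  NonBacktracking (x ∷ y ∷ z ∷ rest) → All (_≢ c) (y ∷ z ∷ rest) →
  NonBacktracking ((x ∷ y ∷ z ∷ rest) ∷ʳ c)
nonBacktracking-∷ʳ x y z []         (x≢z , _)  (y≢c ∷ _) = x≢z , y≢c , tt
nonBacktracking-∷ʳ x y z (w ∷ rest) (x≢z , nb) (_ ∷ ne)  =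
  x≢z , nonBacktracking-∷ʳ y z w rest nb ne

isWalk-∷ʳ : ∀ {n} {H : Graph n} {x c} xs →
  IsWalk H (x ∷ xs) → Adj H (lastOf x xs) c → IsWalk H ((x ∷ xs) ∷ʳ c)
isWalk-∷ʳ []       _                e = walk-cons e (walk-one _)
isWalk-∷ʳ (_ ∷ ys) (walk-cons xy w) e = walk-cons xy (isWalk-∷ʳ ys w e)

module _ {n : ℕ} (H : Graph n) where

  data Walk : Fin n → Fin n → Set where
    []  : ∀ {x} → Walk x x
    _∷_ : ∀ {x y z} → Adj H x y → Walk y z → Walk x z

  _++ʷ_ : ∀ {x y z} → Walk x y → Walk y z → Walk x z
  []      ++ʷ w = w
  (e ∷ v) ++ʷ w = e ∷ (v ++ʷ w)

  reverseʷ : ∀ {x y} → Walk x y → Walk y x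
  reverseʷ []      = []
  reverseʷ (e ∷ w) = reverseʷ w ++ʷ (Graph.sym H e ∷ [])

  vertices : ∀ {x y} → Walk x y → List (Fin n)
  vertices {x} []      = x ∷ []
  vertices {x} (_ ∷ w) = x ∷ vertices w

  vertices-isWalk : ∀ {x y} (w : Walk x y) → IsWalk H (vertices w)
  vertices-isWalk {x} []          = walk-one x
  vertices-isWalk (e ∷ [])        = walk-cons e (walk-one _)
  vertices-isWalk (e ∷ w@(_ ∷ _)) = walk-cons e (vertices-isWalk w)

  head-vertices : ∀ {x y} (w : Walk x y) → head (vertices w) ≡ just x
  head-vertices []      = refl
  head-vertices (_ ∷ _) = refl

  last-vertices : ∀ {x y} (w : Walk x y) → last (vertices w) ≡ just y
  last-vertices []              = refl
  last-vertices (_ ∷ [])        = refl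
  last-vertices (_ ∷ w@(_ ∷ _)) = last-vertices w

  connected-via : (r : Fin n) → (∀ x → Walk x r) → Connected H
  connected-via r path x y = vertices w , vertices-isWalk w , head-vertices w , last-vertices w
    where
    w : Walk x y
    w = path x ++ʷ reverseʷ (path y)

-- Trees given by parent pointers

module _ {A : Set} (root : A) (parent : A → A) where

  ParentEdge : A → A → Set
  ParentEdge x y = (x ≢ root × parent x ≡ y) ⊎ (y ≢ root × parent y ≡ x)

  Siblings : A → A → Set
  Siblings x y = x ≢ root × y ≢ root × parent x ≡ parent y

  Grandparent : A → A → Set
  Grandparent x y = x ≢ root × parent x ≢ root × parent (parent x) ≡ y

  SquareEdge : A → A → Set
  SquareEdge x y = Siblings x y ⊎ (Grandparent x y ⊎ Grandparent y x)

IsDepth : ∀ {A : Set} → A → (A → A) → (A → ℕ) → Set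
IsDepth root parent depth = ∀ x → x ≢ root → depth x ≡ suc (depth (parent x))

squareEdge-transfer : ∀ {A : Set} {root : A} {P Q : A → A} →
  (∀ {x y} → x ≢ root → y ≢ root → P x ≡ P y → Q x ≡ Q y) →
  (∀ {x} → x ≢ root → P x ≢ root → Q x ≢ root × P (P x) ≡ Q (Q x)) →
  ∀ {x y} → SquareEdge root P x y → SquareEdge root Q x y
squareEdge-transfer {root = root} {P} {Q} siblings grandparents = λ where
    (inj₁ (x≢r , y≢r , e)) → inj₁ (x≢r , y≢r , siblings x≢r y≢r e)
    (inj₂ (inj₁ g))        → inj₂ (inj₁ (grandparent g))
    (inj₂ (inj₂ g))        → inj₂ (inj₂ (grandparent g))
  where
  grandparent : ∀ {x y} → Grandparent root P x y → Grandparent root Q x y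
  grandparent (x≢r , px≢r , e) with grandparents x≢r px≢r
  ... | qx≢r , pp≡qq = x≢r , qx≢r , trans (sym pp≡qq) e

module ParentTree {n : ℕ} (root : Fin n) (parent : Fin n → Fin n) (depth : Fin n → ℕ)
                  (isDepth : IsDepth root parent depth) where

  Edge : Fin n → Fin n → Set
  Edge = ParentEdge root parent

  depth-parent : ∀ {x y} → x ≢ root → parent x ≡ y → depth x ≡ suc (depth y)
  depth-parent {x} x≢r refl = isDepth x x≢r

  edge-depth : ∀ {x y} → Edge x y → depth y ≡ suc (depth x) ⊎ depth x ≡ suc (depth y)
  edge-depth (inj₁ (x≢r , px≡y)) = inj₂ (depth-parent x≢r px≡y)
  edge-depth (inj₂ (y≢r , py≡x)) = inj₁ (depth-parent y≢r py≡x)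

  edge-irrefl : ∀ {x} → ¬ Edge x x
  edge-irrefl e with edge-depth e
  ... | inj₁ d = 1+n≢n (sym d)
  ... | inj₂ d = 1+n≢n (sym d)

  tree : Graph n
  tree = record { Adj = Edge ; sym = swap ; irrefl = edge-irrefl }

  -- A vertex has only one neighbour of smaller depth: its parent.
  no-peak : ∀ {x y w} → Edge x y → Edge y w → depth y ≡ suc (depth x) → x ≢ w →
            depth w ≡ suc (depth y)
  no-peak (inj₁ (x≢r , px≡y)) _ up _ =
    ⊥-elim (<-asym (<-of-≡suc up) (<-of-≡suc (depth-parent x≢r px≡y)))
  no-peak (inj₂ (_ , py≡x)) (inj₁ (_ , py≡w)) _ x≢w = ⊥-elim (x≢w (trans (sym py≡x) py≡w))
  no-peak (inj₂ _) (inj₂ (w≢r , pw≡y)) _ _ = depth-parent w≢r pw≡y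

  ascending : ∀ a b rest c →
    IsWalk tree ((a ∷ b ∷ rest) ∷ʳ c) → NonBacktracking ((a ∷ b ∷ rest) ∷ʳ c) →
    depth b ≡ suc (depth a) → depth a < depth c
  ascending a b [] c (walk-cons ab (walk-cons bc _)) (a≢c , _) up =
    <-trans (<-of-≡suc up) (<-of-≡suc (no-peak ab bc up a≢c))
  ascending a b (x ∷ rest) c (walk-cons ab w@(walk-cons bx _)) (a≢x , nb) up =
    <-trans (<-of-≡suc up) (ascending b x rest c w nb (no-peak ab bx up a≢x))

  descending : ∀ a rest c →
    IsWalk tree ((a ∷ rest) ∷ʳ c) → NonBacktracking ((a ∷ rest) ∷ʳ c) →
    depth (lastOf a rest) ≡ suc (depth c) → depth c < depth a
  descending a [] c _ _ down = <-of-≡suc down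
  descending a (b ∷ rest) c w@(walk-cons ab w′) nb down =
    first-step (edge-depth ab)
               (descending b rest c w′ (nonBacktracking-tail (b ∷ (rest ∷ʳ c)) nb) down)
    where
    first-step : depth b ≡ suc (depth a) ⊎ depth a ≡ suc (depth b) →
                 depth c < depth b → depth c < depth a
    first-step (inj₂ a-above) c<b = <-trans c<b (<-of-≡suc a-above)
    first-step (inj₁ b-above) c<b =
      ⊥-elim (<⇒≱ (ascending a b rest c w nb b-above) (s≤s⁻¹ (subst (depth c <_) b-above c<b)))

  -- Close the cycle v₀ … v_k into the non-backtracking walk v₀ … v_k v₀.  It
  -- can neither start upwards nor end downwards, so v₀ would be a peak.
  acyclic : Acyclic tree
  acyclic []              (() , _)
  acyclic (_ ∷ [])        (s≤s () , _)
  acyclic (_ ∷ _ ∷ [])    (s≤s (s≤s ()) , _)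
  acyclic (v₀ ∷ v₁ ∷ z ∷ r)
          (_ , u@(v₀-fresh ∷ v₁-fresh ∷ _) , w@(walk-cons e₀₁ _) ,
           _ , _ , refl , last≡b , b~v₀) =
    impossible
    where
    vₖ = lastOf z r

    just-injective : ∀ {p q : Fin n} → just p ≡ just q → p ≡ q
    just-injective refl = refl

    closing : Edge vₖ v₀
    closing =
      subst (λ t → Edge t v₀) (sym (just-injective (trans (sym (last-∷ z r)) last≡b))) b~v₀

    closed : IsWalk tree ((v₀ ∷ v₁ ∷ z ∷ r) ∷ʳ v₀)
    closed = isWalk-∷ʳ (v₁ ∷ z ∷ r) w closing

    closed-nb : NonBacktracking ((v₀ ∷ v₁ ∷ z ∷ r) ∷ʳ v₀)
    closed-nb = nonBacktracking-∷ʳ v₀ v₁ z r (unique⇒nonBacktracking u) (All-map ≢-sym v₀-fresh)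

    vₖ≢v₁ : vₖ ≢ v₁
    vₖ≢v₁ = ≢-sym (All-lookup v₁-fresh (lastOf-∈ z r))

    impossible : ⊥
    impossible with edge-depth e₀₁ | edge-depth closing
    ... | inj₁ up   | _         = <-irrefl refl (ascending v₀ v₁ (z ∷ r) v₀ closed closed-nb up)
    ... | inj₂ down | inj₁ peak =
      <-asym (<-of-≡suc down) (<-of-≡suc (no-peak closing e₀₁ peak vₖ≢v₁))
    ... | inj₂ _    | inj₂ vₖ-above =
      <-irrefl refl (descending v₀ (v₁ ∷ z ∷ r) v₀ closed closed-nb vₖ-above)

  path-to-root : ∀ k x → depth x ≡ k → Walk tree x root
  path-to-root k x _ with x ≟ root
  ... | yes refl = []
  path-to-root zero    x d≡0 | no x≢r with trans (sym d≡0) (isDepth x x≢r)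
  ... | ()
  path-to-root (suc k) x d≡k | no x≢r =
    inj₁ (x≢r , refl) ∷
    path-to-root k (parent x) (suc-injective (trans (sym (isDepth x x≢r)) d≡k))

  isTree : IsTree tree
  isTree =
    ≤-trans (s≤s z≤n) (toℕ<n root) ,
    connected-via tree root (λ x → path-to-root (depth x) x refl) ,
    acyclic

  siblings⇒same-depth : ∀ {x y} → Siblings root parent x y → depth x ≡ depth y
  siblings⇒same-depth (x≢r , y≢r , e) =
    trans (isDepth _ x≢r) (trans (cong (suc ∘ depth) e) (sym (isDepth _ y≢r)))

  grandparent⇒depth : ∀ {x y} → Grandparent root parent x y → depth x ≡ suc (suc (depth y))
  grandparent⇒depth (x≢r , px≢r , e) = trans (isDepth _ x≢r) (cong suc (depth-parent px≢r e))

  ¬edge-same-depth : ∀ {x y} → depth x ≡ depth y → ¬ Edge x y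
  ¬edge-same-depth dx≡dy e with edge-depth e
  ... | inj₁ y-below = <-irrefl dx≡dy (<-of-≡suc y-below)
  ... | inj₂ x-below = <-irrefl (sym dx≡dy) (<-of-≡suc x-below)

  ¬edge-two-apart : ∀ {x y} → depth x ≡ suc (suc (depth y)) → ¬ Edge x y
  ¬edge-two-apart gap e with edge-depth e
  ... | inj₁ y-below = <-asym (<-of-≡suc y-below) (<-trans (<-of-≡suc refl) (<-of-≡suc gap))
  ... | inj₂ x-below = 1+n≢n (sym (suc-injective (trans (sym x-below) gap)))

  distTwo⇒squareEdge : ∀ {x y} → DistTwo tree x y → SquareEdge root parent x y
  distTwo⇒squareEdge (_ , _ , _ , inj₁ (x≢r , px≡z) , inj₁ (z≢r , pz≡y)) =
    inj₂ (inj₁ (x≢r , (λ e → z≢r (trans (sym px≡z) e)) , trans (cong parent px≡z) pz≡y))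
  distTwo⇒squareEdge (_ , _ , _ , inj₁ (x≢r , px≡z) , inj₂ (y≢r , py≡z)) =
    inj₁ (x≢r , y≢r , trans px≡z (sym py≡z))
  distTwo⇒squareEdge (x≢y , _ , _ , inj₂ (_ , pz≡x) , inj₁ (_ , pz≡y)) =
    ⊥-elim (x≢y (trans (sym pz≡x) pz≡y))
  distTwo⇒squareEdge (_ , _ , _ , inj₂ (z≢r , pz≡x) , inj₂ (y≢r , py≡z)) =
    inj₂ (inj₂ (y≢r , (λ e → z≢r (trans (sym py≡z) e)) , trans (cong parent py≡z) pz≡x))

  squareEdge⇒distTwo : ∀ {x y} → x ≢ y → SquareEdge root parent x y → DistTwo tree x y
  squareEdge⇒distTwo {x} x≢y (inj₁ s@(x≢r , y≢r , e)) =
    x≢y , ¬edge-same-depth (siblings⇒same-depth s) ,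
    parent x , inj₁ (x≢r , refl) , inj₂ (y≢r , sym e)
  squareEdge⇒distTwo {x} x≢y (inj₂ (inj₁ g@(x≢r , px≢r , e))) =
    x≢y , ¬edge-two-apart (grandparent⇒depth g) ,
    parent x , inj₁ (x≢r , refl) , inj₁ (px≢r , e)
  squareEdge⇒distTwo {y = y} x≢y (inj₂ (inj₂ g@(y≢r , py≢r , e))) =
    x≢y , ¬edge-two-apart (grandparent⇒depth g) ∘ swap ,
    parent y , inj₂ (py≢r , e) , inj₂ (y≢r , refl)

exactSq-iso : ∀ {n} {root : Fin n} {P Q : Fin n → Fin n} {depth : Fin n → ℕ}
  (isDepthP : IsDepth root P depth) (isDepthQ : IsDepth root Q depth) →
  (∀ {x y} → SquareEdge root P x y → SquareEdge root Q x y) →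
  (∀ {x y} → SquareEdge root Q x y → SquareEdge root P x y) →
  Iso (ExactSq (ParentTree.tree root P depth isDepthP))
      (ExactSq (ParentTree.tree root Q depth isDepthQ))
exactSq-iso {root = root} {P} {Q} {depth} isDepthP isDepthQ P⊆Q Q⊆P = ↔-refl , λ _ _ → mk⇔
  (λ d₂ → TQ.squareEdge⇒distTwo (proj₁ d₂) (P⊆Q (TP.distTwo⇒squareEdge d₂)))
  (λ d₂ → TP.squareEdge⇒distTwo (proj₁ d₂) (Q⊆P (TQ.distTwo⇒squareEdge d₂)))
  where
  module TP = ParentTree root P depth isDepthP
  module TQ = ParentTree root Q depth isDepthQ

-- Counting neighbours

module _ {V : Set} (R : V → V → Set) where

  record Star (v : V) (k : ℕ) : Set where
    field
      spoke     : Fin k → V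
      adjacent  : ∀ i → R v (spoke i)
      injective : Injective _≡_ _≡_ spoke

  record Cover (v : V) (m : ℕ) : Set where
    field
      point  : Fin m → V
      covers : ∀ {w} → R v w → ∃[ j ] point j ≡ w

star≤cover : ∀ {V : Set} {R : V → V → Set} {v k m} → Star R v k → Cover R v m → k ≤ m
star≤cover star cover = injective⇒≤ index-injective
  where
  open Star star
  open Cover cover
  open ≡-Reasoning

  index : Fin _ → Fin _
  index i = proj₁ (covers (adjacent i))

  index-injective : Injective _≡_ _≡_ index
  index-injective {i} {i′} e = injective (begin
    spoke i           ≡⟨ sym (proj₂ (covers (adjacent i))) ⟩
    point (index i)   ≡⟨ cong point e ⟩
    point (index i′)  ≡⟨ proj₂ (covers (adjacent i′)) ⟩
    spoke i′          ∎)

record Embedding {V W : Set} (R : V → V → Set) (S : W → W → Set) : Set where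
  field
    map       : V → W
    injective : Injective _≡_ _≡_ map
    preserves : ∀ {x y} → R x y → S (map x) (map y)

star-map : ∀ {V W : Set} {R : V → V → Set} {S : W → W → Set} {v k} →
  (e : Embedding R S) → Star R v k → Star S (Embedding.map e v) k
star-map e star = record
  { spoke     = map ∘ spoke
  ; adjacent  = preserves ∘ adjacent
  ; injective = Star.injective star ∘ injective
  }
  where
  open Embedding e
  open Star star using (spoke; adjacent)

iso⇒embedding : ∀ {n m} {G : Graph n} {H : Graph m} → Iso G H → Embedding (Adj G) (Adj H)
iso⇒embedding (f , adj) = record
  { map       = to
  ; injective = λ {x} {y} e →
      trans (sym (strictlyInverseʳ x)) (trans (cong from e) (strictlyInverseʳ y))
  ; preserves = Equivalence.to (adj _ _)
  }
  where open Inverse f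

iso-sym : ∀ {n m} {G : Graph n} {H : Graph m} → Iso G H → Iso H G
iso-sym {H = H} (f , adj) = ↔-sym f , λ x y → mk⇔
  (λ a → Equivalence.from (adj (from x) (from y))
           (subst₂ (Adj H) (sym (strictlyInverseˡ x)) (sym (strictlyInverseˡ y)) a))
  (λ a → subst₂ (Adj H) (strictlyInverseˡ x) (strictlyInverseˡ y) (Equivalence.to (adj _ _) a))
  where open Inverse f

Σ-Fin↔ : ∀ k (f : Vector ℕ k) → Σ (Fin k) (Fin ∘ f) ↔ Fin (foldr _+_ 0 f)
Σ-Fin↔ zero    f = mk↔ₛ′ (λ { (() , _) }) (λ ()) (λ ()) (λ { (() , _) })
Σ-Fin↔ (suc k) f = ↔-trans split (↔-trans (↔-refl ⊎-↔ Σ-Fin↔ k (f ∘ suc)) (↔-sym +↔⊎))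
  where
  split : Σ (Fin (suc k)) (Fin ∘ f) ↔ (Fin (f zero) ⊎ Σ (Fin k) (Fin ∘ f ∘ suc))
  split = mk↔ₛ′
    (λ { (zero , a) → inj₁ a ; (suc j , a) → inj₂ (j , a) })
    (λ { (inj₁ a) → zero , a ; (inj₂ (j , a)) → suc j , a })
    (λ { (inj₁ a) → refl ; (inj₂ (j , a)) → refl })
    (λ { (zero , a) → refl ; (suc j , a) → refl })

-- The roots

module Construction (N : ℕ) where

  K A : ℕ
  K = suc N
  -- more than the degree of any vertex other than the hub
  A = suc K

  groupSize : Vector ℕ K
  groupSize j = suc (toℕ j)

  data V : Set where
    cv : V
    xv : Fin K → V
    yv : (j : Fin K) → Fin (groupSize j) → V
    zv : Fin A → V

  xv-injective : ∀ {i i′} → xv i ≡ xv i′ → i ≡ i′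
  xv-injective refl = refl

  τ : Fin K → Fin K → Fin K
  τ s = Perm.transpose s zero

  τ-self : ∀ s → τ s s ≡ zero
  -- transpose zero s zero reduces to s
  τ-self s = Perm.transpose-inverse s zero

  τ-inverse : ∀ {s j i} → τ s j ≡ i → j ≡ Perm.transpose zero s i
  τ-inverse {s} refl = sym (Perm.transpose-inverse zero s)

  τ-injective : ∀ s → Injective _≡_ _≡_ (τ s)
  τ-injective s e = trans (τ-inverse e) (sym (τ-inverse refl))

  parentᵛ : Fin K → V → V
  parentᵛ s cv       = cv
  parentᵛ s (xv _)   = cv
  parentᵛ s (yv j _) = xv (τ s j)
  parentᵛ s (zv _)   = yv s zero

  depthᵛ : V → ℕ
  depthᵛ cv       = 0
  depthᵛ (xv _)   = 1
  depthᵛ (yv _ _) = 2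
  depthᵛ (zv _)   = 3

  isDepthᵛ : ∀ s → IsDepth cv (parentᵛ s) depthᵛ
  isDepthᵛ s cv c≢c = ⊥-elim (c≢c refl)
  isDepthᵛ s (xv _)   _ = refl
  isDepthᵛ s (yv _ _) _ = refl
  isDepthᵛ s (zv _)   _ = refl

  siblingsᵛ : ∀ s s′ {u w} → u ≢ cv → w ≢ cv →
    parentᵛ s u ≡ parentᵛ s w → parentᵛ s′ u ≡ parentᵛ s′ w
  siblingsᵛ s s′ {cv}              u≢c _ _ = ⊥-elim (u≢c refl)
  siblingsᵛ s s′ {_}      {cv}     _ w≢c _ = ⊥-elim (w≢c refl)
  siblingsᵛ s s′ {xv _}   {xv _}   _ _ _   = refl
  siblingsᵛ s s′ {xv _}   {yv _ _} _ _ ()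
  siblingsᵛ s s′ {xv _}   {zv _}   _ _ ()
  siblingsᵛ s s′ {yv _ _} {xv _}   _ _ ()
  siblingsᵛ s s′ {yv j _} {yv j′ _} _ _ e =
    cong (xv ∘ τ s′) (τ-injective s {j} {j′} (xv-injective e))
  siblingsᵛ s s′ {yv _ _} {zv _}   _ _ ()
  siblingsᵛ s s′ {zv _}   {xv _}   _ _ ()
  siblingsᵛ s s′ {zv _}   {yv _ _} _ _ ()
  siblingsᵛ s s′ {zv _}   {zv _}   _ _ _   = refl

  grandparentsᵛ : ∀ s s′ {u} → u ≢ cv → parentᵛ s u ≢ cv →
    parentᵛ s′ u ≢ cv × parentᵛ s (parentᵛ s u) ≡ parentᵛ s′ (parentᵛ s′ u)
  grandparentsᵛ s s′ {cv}     u≢c _   = ⊥-elim (u≢c refl)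
  grandparentsᵛ s s′ {xv _}   _   p≢c = ⊥-elim (p≢c refl)
  grandparentsᵛ s s′ {yv _ _} _   _   = (λ ()) , refl
  grandparentsᵛ s s′ {zv _}   _   _   = (λ ()) , cong xv (trans (τ-self s) (sym (τ-self s′)))

  n : ℕ
  n = suc (K + (foldr _+_ 0 groupSize + A))

  encoding : V ↔ Fin n
  encoding = ↔-trans components (↔-sym (↔-trans (+↔⊎ {1}) (1↔⊤ ⊎-↔ ↔-trans +↔⊎
    (↔-refl ⊎-↔ ↔-trans +↔⊎ (↔-sym (Σ-Fin↔ K groupSize) ⊎-↔ ↔-refl)))))
    where
    components : V ↔ (⊤ ⊎ (Fin K ⊎ (Σ (Fin K) (Fin ∘ groupSize) ⊎ Fin A)))
    components = mk↔ₛ′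
      (λ { cv → inj₁ tt ; (xv i) → inj₂ (inj₁ i) ; (yv j a) → inj₂ (inj₂ (inj₁ (j , a)))
         ; (zv b) → inj₂ (inj₂ (inj₂ b)) })
      (λ { (inj₁ tt) → cv ; (inj₂ (inj₁ i)) → xv i ; (inj₂ (inj₂ (inj₁ (j , a)))) → yv j a
         ; (inj₂ (inj₂ (inj₂ b))) → zv b })
      (λ { (inj₁ tt) → refl ; (inj₂ (inj₁ i)) → refl ; (inj₂ (inj₂ (inj₁ (j , a)))) → refl
         ; (inj₂ (inj₂ (inj₂ b))) → refl })
      (λ { cv → refl ; (xv i) → refl ; (yv j a) → refl ; (zv b) → refl })

  open Inverse encoding public using ()
    renaming (to to toV; from to fromV; strictlyInverseˡ to toV-fromV; strictlyInverseʳ to fromV-toV)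

  toV-injective : Injective _≡_ _≡_ toV
  toV-injective {u} {w} e = trans (sym (fromV-toV u)) (trans (cong fromV e) (fromV-toV w))

  fromV-injective : Injective _≡_ _≡_ fromV
  fromV-injective {x} {y} e = trans (sym (toV-fromV x)) (trans (cong toV e) (toV-fromV y))

  _≟ᵛ_ : (u w : V) → Dec (u ≡ w)
  u ≟ᵛ w = map′ toV-injective (cong toV) (toV u ≟ toV w)

  root : Fin n
  root = toV cv

  parent : Fin K → Fin n → Fin n
  parent s = toV ∘ parentᵛ s ∘ fromV

  depth : Fin n → ℕ
  depth = depthᵛ ∘ fromV

  parent-toV : ∀ s u → parent s (toV u) ≡ toV (parentᵛ s u)
  parent-toV s u = cong (toV ∘ parentᵛ s) (fromV-toV u)

  ≢root⇒≢cv : ∀ {x} → x ≢ root → fromV x ≢ cv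
  ≢root⇒≢cv {x} x≢r e = x≢r (trans (sym (toV-fromV x)) (cong toV e))

  isDepth : ∀ s → IsDepth root (parent s) depth
  isDepth s x x≢r =
    trans (isDepthᵛ s (fromV x) (≢root⇒≢cv x≢r)) (cong (suc ∘ depthᵛ) (sym (fromV-toV _)))

  T : Fin K → Graph n
  T s = ParentTree.tree root (parent s) depth (isDepth s)

  T-isTree : ∀ s → IsTree (T s)
  T-isTree s = ParentTree.isTree root (parent s) depth (isDepth s)

  squareEdge-independent : ∀ s s′ {x y} →
    SquareEdge root (parent s) x y → SquareEdge root (parent s′) x y
  squareEdge-independent s s′ = squareEdge-transfer siblings grandparents
    where
    open ≡-Reasoning

    siblings : ∀ {x y} → x ≢ root → y ≢ root →
      parent s x ≡ parent s y → parent s′ x ≡ parent s′ y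
    siblings x≢r y≢r e =
      cong toV (siblingsᵛ s s′ (≢root⇒≢cv x≢r) (≢root⇒≢cv y≢r) (toV-injective e))

    grandparents : ∀ {x} → x ≢ root → parent s x ≢ root →
      parent s′ x ≢ root × parent s (parent s x) ≡ parent s′ (parent s′ x)
    grandparents {x} x≢r px≢r with grandparentsᵛ s s′ (≢root⇒≢cv x≢r) (px≢r ∘ cong toV)
    ... | p′u≢c , pp≡p′p′ = p′u≢c ∘ toV-injective , (begin
      parent s (parent s x)                    ≡⟨ parent-toV s (parentᵛ s (fromV x)) ⟩
      toV (parentᵛ s (parentᵛ s (fromV x)))    ≡⟨ cong toV pp≡p′p′ ⟩
      toV (parentᵛ s′ (parentᵛ s′ (fromV x)))  ≡⟨ parent-toV s′ (parentᵛ s′ (fromV x)) ⟨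
      parent s′ (parent s′ x)                  ∎)

  exactSq-independent : ∀ s s′ → Iso (ExactSq (T s)) (ExactSq (T s′))
  exactSq-independent s s′ = exactSq-iso (isDepth s) (isDepth s′)
    (squareEdge-independent s s′) (squareEdge-independent s′ s)

  Edgeᵛ : Fin K → V → V → Set
  Edgeᵛ s = ParentEdge cv (parentᵛ s)

  edge-fromV : ∀ s {x y} → Adj (T s) x y → Edgeᵛ s (fromV x) (fromV y)
  edge-fromV s (inj₁ (x≢r , e)) =
    inj₁ (≢root⇒≢cv x≢r , trans (sym (fromV-toV _)) (cong fromV e))
  edge-fromV s (inj₂ (y≢r , e)) =
    inj₂ (≢root⇒≢cv y≢r , trans (sym (fromV-toV _)) (cong fromV e))

  edge-toV : ∀ s {u w} → Edgeᵛ s u w → Adj (T s) (toV u) (toV w)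
  edge-toV s {u} (inj₁ (u≢c , e)) =
    inj₁ (u≢c ∘ toV-injective , trans (parent-toV s u) (cong toV e))
  edge-toV s {w = w} (inj₂ (w≢c , e)) =
    inj₂ (w≢c ∘ toV-injective , trans (parent-toV s w) (cong toV e))

  iso⇒embeddingᵛ : ∀ {s s′} → Iso (T s) (T s′) → Embedding (Edgeᵛ s) (Edgeᵛ s′)
  iso⇒embeddingᵛ {s} {s′} iso = record
    { map       = fromV ∘ map ∘ toV
    ; injective = λ e → toV-injective (injective (fromV-injective e))
    ; preserves = edge-fromV s′ ∘ preserves ∘ edge-toV s
    }
    where open Embedding (iso⇒embedding {G = T s} {T s′} iso)

  hub-star : ∀ s → Star (Edgeᵛ s) (yv s zero) (suc A)
  hub-star s = record { spoke = spoke ; adjacent = adjacent ; injective = injective }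
    where
    spoke : Fin (suc A) → V
    spoke zero    = xv zero
    spoke (suc b) = zv b

    adjacent : ∀ i → Edgeᵛ s (yv s zero) (spoke i)
    adjacent zero    = inj₁ ((λ ()) , cong xv (τ-self s))
    adjacent (suc b) = inj₂ ((λ ()) , refl)

    injective : Injective _≡_ _≡_ spoke
    injective {zero}  {zero}  _    = refl
    injective {zero}  {suc _} ()
    injective {suc _} {zero}  ()
    injective {suc _} {suc _} refl = refl

  x₀-star : ∀ s → Star (Edgeᵛ s) (xv zero) (suc (suc (toℕ s)))
  x₀-star s = record { spoke = spoke ; adjacent = adjacent ; injective = injective }
    where
    spoke : Fin (suc (suc (toℕ s))) → V
    spoke zero    = cv
    spoke (suc a) = yv s a

    adjacent : ∀ i → Edgeᵛ s (xv zero) (spoke i)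
    adjacent zero    = inj₁ ((λ ()) , refl)
    adjacent (suc a) = inj₂ ((λ ()) , cong xv (τ-self s))

    injective : Injective _≡_ _≡_ spoke
    injective {zero}  {zero}  _    = refl
    injective {zero}  {suc _} ()
    injective {suc _} {zero}  ()
    injective {suc _} {suc _} refl = refl

  cv-cover : ∀ s → Cover (Edgeᵛ s) cv K
  cv-cover s = record { point = xv ; covers = λ where
      (inj₁ (c≢c , _)) → ⊥-elim (c≢c refl)
      (inj₂ (w≢c , e)) → child w≢c e }
    where
    child : ∀ {w} → w ≢ cv → parentᵛ s w ≡ cv → ∃[ i ] xv i ≡ w
    child {cv}     w≢c _ = ⊥-elim (w≢c refl)
    child {xv i}   _   _ = i , refl
    child {yv _ _} _   ()
    child {zv _}   _   ()

  xv-cover : ∀ s i → Cover (Edgeᵛ s) (xv i) (suc (suc (toℕ (Perm.transpose zero s i))))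
  xv-cover s i = record { point = point ; covers = covers }
    where
    point : Fin (suc (suc (toℕ (Perm.transpose zero s i)))) → V
    point zero    = cv
    point (suc a) = yv (Perm.transpose zero s i) a

    child : ∀ {w} → w ≢ cv → parentᵛ s w ≡ xv i → ∃[ k ] point k ≡ w
    child {cv}     w≢c _ = ⊥-elim (w≢c refl)
    child {xv _}   _   ()
    child {yv j a} _   e with τ-inverse {s} {j} (xv-injective e)
    ... | refl = suc a , refl
    child {zv _}   _   ()

    covers : ∀ {w} → Edgeᵛ s (xv i) w → ∃[ k ] point k ≡ w
    covers (inj₁ (_ , refl)) = zero , refl
    covers (inj₂ (w≢c , e))  = child w≢c e

  zv-cover : ∀ s b → Cover (Edgeᵛ s) (zv b) 1
  zv-cover s b = record { point = λ _ → yv s zero ; covers = covers }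
    where
    covers : ∀ {w} → Edgeᵛ s (zv b) w → ∃[ k ] yv s zero ≡ w
    covers (inj₁ (_ , e)) = zero , e
    covers {cv}     (inj₂ (w≢c , _)) = ⊥-elim (w≢c refl)
    covers {xv _}   (inj₂ (_ , ()))
    covers {yv _ _} (inj₂ (_ , ()))
    covers {zv _}   (inj₂ (_ , ()))

  yv-cover : ∀ s {j a} → yv j a ≢ yv s zero → Cover (Edgeᵛ s) (yv j a) 1
  yv-cover s {j} {a} not-hub = record { point = λ _ → xv (τ s j) ; covers = covers }
    where
    covers : ∀ {w} → Edgeᵛ s (yv j a) w → ∃[ k ] xv (τ s j) ≡ w
    covers (inj₁ (_ , e)) = zero , e
    covers {cv}     (inj₂ (w≢c , _)) = ⊥-elim (w≢c refl)
    covers {xv _}   (inj₂ (_ , ()))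
    covers {yv _ _} (inj₂ (_ , ()))
    covers {zv _}   (inj₂ (_ , e))   = ⊥-elim (not-hub (sym e))

  hub-unique : ∀ s {v} → Star (Edgeᵛ s) v (suc A) → v ≡ yv s zero
  hub-unique s {cv}   star = ⊥-elim (<⇒≱ (star≤cover star (cv-cover s)) (n≤1+n K))
  hub-unique s {xv i} star =
    ⊥-elim (<⇒≱ (star≤cover star (xv-cover s i))
                (s≤s (s≤s (toℕ≤pred[n] (Perm.transpose zero s i)))))
  hub-unique s {yv j a} star with yv j a ≟ᵛ yv s zero
  ... | yes is-hub  = is-hub
  ... | no  not-hub = ⊥-elim (<⇒≱ (star≤cover star (yv-cover s not-hub)) (s≤s z≤n))
  hub-unique s {zv b} star = ⊥-elim (<⇒≱ (star≤cover star (zv-cover s b)) (s≤s z≤n))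

  hub-neighbour : ∀ s {w} → Edgeᵛ s (yv s zero) w → w ≡ xv zero ⊎ ∃[ b ] w ≡ zv b
  hub-neighbour s (inj₁ (_ , e))          = inj₁ (trans (sym e) (cong xv (τ-self s)))
  hub-neighbour s {cv}   (inj₂ (c≢c , _)) = ⊥-elim (c≢c refl)
  hub-neighbour s {xv _}   (inj₂ (_ , ()))
  hub-neighbour s {yv _ _} (inj₂ (_ , ()))
  hub-neighbour s {zv b}   (inj₂ _)       = inj₂ (b , refl)

  -- An embedding fixes the hub, so it sends x₀, which has toℕ s + 2 neighbours,
  -- to a neighbour of the hub, which has at most toℕ s′ + 2.
  no-embedding : ∀ {s s′} → toℕ s′ < toℕ s → ¬ Embedding (Edgeᵛ s) (Edgeᵛ s′)
  no-embedding {s} {s′} s′<s e = image-of-x₀ (hub-neighbour s′ x₀↦hub-neighbour)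
    where
    open Embedding e

    hub↦hub : map (yv s zero) ≡ yv s′ zero
    hub↦hub = hub-unique s′ (star-map e (hub-star s))

    x₀↦hub-neighbour : Edgeᵛ s′ (yv s′ zero) (map (xv zero))
    x₀↦hub-neighbour = subst (λ v → Edgeᵛ s′ v (map (xv zero))) hub↦hub
                             (preserves (Star.adjacent (hub-star s) zero))

    image-bound : ∀ {v m} → map (xv zero) ≡ v → Cover (Edgeᵛ s′) v m →
                  suc (suc (toℕ s)) ≤ m
    image-bound refl = star≤cover (star-map e (x₀-star s))

    image-of-x₀ : map (xv zero) ≡ xv zero ⊎ ∃[ b ] map (xv zero) ≡ zv b → ⊥
    image-of-x₀ (inj₁ x₀↦x₀) =
      <⇒≱ s′<s (s≤s⁻¹ (s≤s⁻¹ (image-bound x₀↦x₀ (xv-cover s′ zero))))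
    image-of-x₀ (inj₂ (b , x₀↦z)) with image-bound x₀↦z (zv-cover s′ b)
    ... | s≤s ()

  T-distinct : ∀ {s s′} → s ≢ s′ → ¬ Iso (T s) (T s′)
  T-distinct {s} {s′} s≢s′ iso with <-cmp (toℕ s) (toℕ s′)
  ... | tri< s<s′ _ _ = no-embedding s<s′ (iso⇒embeddingᵛ (iso-sym {G = T s} {T s′} iso))
  ... | tri≈ _ s≡s′ _ = s≢s′ (toℕ-injective s≡s′)
  ... | tri> _ _ s′<s = no-embedding s′<s (iso⇒embeddingᵛ iso)

theorem4 : ∀ (m : ℕ) → 2 ≤ m →
    ∃[ n ] Σ (Graph n) λ G → Σ (Fin (m !) → Graph n) λ T →
    (∀ i → IsTree (T i) × Iso (ExactSq (T i)) G) ×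
    (∀ i j → i ≢ j → ¬ Iso (T i) (T j))
theorem4 m _ =
  n , ExactSq (T zero) , T ∘ suc ,
  (λ i → T-isTree (suc i) , exactSq-independent (suc i) zero) ,
  (λ i j i≢j → T-distinct (i≢j ∘ Fin-suc-injective))
  where open Construction (m !)
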